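{- Let $S$ be a set with an entailment relation $\rhd$, let $j$ be a nucleus on $\rhd$, and let $r$ be a rule holding for $\rhd$. The following are equivalent: (a) $r$ is compatible with $j$; (b) for every instance of $r$ with premisses $U_1\rhd b_1,\dots,U_n\rhd b_n$ and conclusion $U\rhd b$, there is $\beta\in S$ such that $\beta\rhd jb$ and such that, whenever $U_1\rhd jb_1,\dots,U_n\rhd jb_n$ all hold, also $U\rhd\beta$ holds.
   Context: A finite set is one that can be written as $\{a_1,\dots,a_n\}$ for some $n\ge 0$; $\mathrm{Fin}(S)$ is the set of finite subsets of $S$. We write $U,V$ for $U\cup V$ and $U,b$ for $U\cup\{b\}$. An entailment relation on $S$ is a relation ${\rhd}\subseteq \mathrm{Fin}(S)\times S$ such that for all finite $U,U',V,V'\subseteq S$ and $a,b\in S$: (R) if $a\in U$ then $U\rhd a$; (T) if $V\rhd b$ and $V',b\rhd a$ then $V,V'\rhd a$; (M) if $U\rhd a$ then $U,U'\rhd a$. A rule is a schema of closure conditions, each instance of which has finitely many premisses $U_i\rhd b_i$ and a conclusion $U\rhd b$; it holds for a relation if for each instance, whenever all premisses hold so does the conclusion. A nucleus on $\rhd$ is a map $j\colon S\to S$ such that for all $a,b\in S$, $U\in\mathrm{Fin}(S)$: (L$j$) if $U,a\rhd jb$ then $U,ja\rhd jb$; (R$j$) if $U\rhd b$ then $U\rhd jb$. The weak $j$-extension is $\rhd_j$ defined by $U\rhd_j a$ iff $U\rhd ja$. A rule holding for $\rhd$ is compatible with $j$ if it also holds for $\rhd_j$. -}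

module Defs where

open import Level using (Level; _⊔_; suc)
open import Data.List using (List; []; _∷_; _++_; [_])
open import Data.List.Membership.Propositional using (_∈_)
open import Data.List.Relation.Binary.Subset.Propositional using (_⊆_)
open import Data.List.Relation.Unary.All using (All)
open import Data.Product using (_×_; _,_; Σ; proj₁; proj₂)

-- Finite subsets of S are represented by lists; two lists denote the same
-- finite subset iff they have the same elements.
FinS : Set → Set
FinS S = List S

_≈ₛ_ : {S : Set} → FinS S → FinS S → Set
U ≈ₛ V = (U ⊆ V) × (V ⊆ U)

Rel▷ : Set → Set₁
Rel▷ S = FinS S → S → Set

-- An entailment relation on S.  Since the relation lives on finite subsets,
-- we require it to be invariant under equality of the denoted subsets.
record IsEntailment {S : Set} (_▷_ : Rel▷ S) : Set where
  field
    ext  : ∀ {U V : FinS S} {a : S} → U ≈ₛ V → U ▷ a → V ▷ a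
    refl : ∀ {U : FinS S} {a : S} → a ∈ U → U ▷ a
    trans : ∀ {V V' : FinS S} {a b : S} → V ▷ b → (b ∷ V') ▷ a → (V ++ V') ▷ a
    mono : ∀ {U U' : FinS S} {a : S} → U ▷ a → (U ++ U') ▷ a

Sequent : Set → Set
Sequent S = FinS S × S

record Rule (S : Set) : Set₁ where
  field
    Inst       : Set
    premisses  : Inst → List (Sequent S)
    conclusion : Inst → Sequent S

HoldsSeq : {S : Set} → Rel▷ S → Sequent S → Set
HoldsSeq _▷_ (U , b) = U ▷ b

RuleHolds : {S : Set} → Rule S → Rel▷ S → Set
RuleHolds r _▷_ = ∀ (i : Rule.Inst r) →
  All (HoldsSeq _▷_) (Rule.premisses r i) → HoldsSeq _▷_ (Rule.conclusion r i)

record IsNucleus {S : Set} (_▷_ : Rel▷ S) (j : S → S) : Set where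
  field
    Lj : ∀ {U : FinS S} {a b : S} → (a ∷ U) ▷ j b → (j a ∷ U) ▷ j b
    Rj : ∀ {U : FinS S} {b : S} → U ▷ b → U ▷ j b

weakExt : {S : Set} → Rel▷ S → (S → S) → Rel▷ S
weakExt _▷_ j U a = U ▷ j a

Compatible : {S : Set} → Rule S → Rel▷ S → (S → S) → Set
Compatible r _▷_ j = RuleHolds r (weakExt _▷_ j)

ConditionB : {S : Set} → Rule S → Rel▷ S → (S → S) → Set
ConditionB r _▷_ j = ∀ (i : Rule.Inst r) →
  Σ _ λ β →
    ([ β ] ▷ j (proj₂ (Rule.conclusion r i))) ×
    (All (HoldsSeq (weakExt _▷_ j)) (Rule.premisses r i) →
      proj₁ (Rule.conclusion r i) ▷ β)

module Submission where

open import Defs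
open import Function.Bundles using (_⇔_; mk⇔)
open import Data.List using (_++_; [_])
open import Data.List.Properties using (++-identityʳ)
open import Data.List.Relation.Unary.Any using (here)
open import Data.Product using (_,_; proj₂)
open import Relation.Binary.PropositionalEquality using (refl; subst)

module _ {S : Set} {_▷_ : Rel▷ S} (E : IsEntailment _▷_) where
  open IsEntailment E using (trans) renaming (refl to ▷-refl)

  cut-singleton : ∀ {U : FinS S} {β c : S} → U ▷ β → [ β ] ▷ c → U ▷ c
  cut-singleton {U} U▷β β▷c = subst (_▷ _) (++-identityʳ U) (trans U▷β β▷c)

  module _ (j : S → S) (r : Rule S) where

    -- The witness is β = j b itself.
    compatible⇒conditionB : Compatible r _▷_ j → ConditionB r _▷_ j
    compatible⇒conditionB compat i =
      j (proj₂ (Rule.conclusion r i)) , ▷-refl (here refl) , compat i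

    conditionB⇒compatible : ConditionB r _▷_ j → Compatible r _▷_ j
    conditionB⇒compatible condB i premisses with condB i
    ... | β , β▷jb , U▷β = cut-singleton (U▷β premisses) β▷jb

lemma3p12 : {S : Set} (_▷_ : Rel▷ S) (j : S → S) (r : Rule S) →
    IsEntailment _▷_ → IsNucleus _▷_ j → RuleHolds r _▷_ →
    Compatible r _▷_ j ⇔ ConditionB r _▷_ j
lemma3p12 _▷_ j r E _ _ =
  mk⇔ (compatible⇒conditionB E j r) (conditionB⇒compatible E j r)
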